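{- Let $n\ge2$ and $2\le k\le n$. Summed over all $\Pi\in S^3_n$, the total number of $k$-plateaux equals \[(n-k+1)!\,(n-k)!\left(\frac{n!}{(n-k)!}+2\sum_{\ell=k-1}^{n-2}\frac{(\ell+1)!}{(\ell+1-k)!}\right).\]
   Context: $S_n$ is the set of permutations of $\{0,\dots,n-1\}$ in one-line notation. $S^3_n$ is the set of pairs $\Pi=(\pi^2,\pi^3)$ of elements of $S_n$, with elements (columns) $\Pi_j=(\pi^2_j,\pi^3_j)^T$ and (sum) level $\mathrm{lev}(\Pi_j)=\pi^2_j+\pi^3_j$. A $k$-plateau of $\Pi$ (occurrence of the consecutive pattern $\underline{11\cdots1}$ with $k$ ones) is an index $i$ with $1\le i\le n-k+1$ such that $\mathrm{lev}(\Pi_i)=\mathrm{lev}(\Pi_{i+1})=\dots=\mathrm{lev}(\Pi_{i+k-1})$. -}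

module Defs where

open import Data.Nat using (ℕ; zero; suc; _+_; _*_; _∸_; _≤_; _/_; _≟_)
open import Data.Nat.Properties using (_!≢0)
open import Data.Nat.Base using (_!)
open import Data.Fin using (Fin; toℕ)
import Data.Fin.Properties as FinP
open import Data.Vec using (Vec; []; _∷_; toList)
open import Data.List using (List; []; _∷_; concatMap; map; filter; length; upTo; cartesianProduct; allFin; drop; take; zipWith)
open import Data.Nat.ListAction using (sum)
open import Data.List.Relation.Unary.Unique.Propositional using (Unique)
import Data.List.Relation.Unary.Unique.DecPropositional as UD
open import Data.List.Relation.Unary.All using (All; all?)
open import Data.Product using (_×_; _,_)
open import Relation.Nullary using (Dec)
open import Relation.Binary.PropositionalEquality using (_≡_)

allWords : (n m : ℕ) → List (Vec (Fin n) m)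
allWords n zero = [] ∷ []
allWords n (suc m) =
  concatMap (λ w → map (λ a → a ∷ w) (allFin n)) (allWords n m)

-- a permutation of {0,…,n-1} in one-line notation: a word of length n
-- over {0,…,n-1} with pairwise distinct entries
IsPerm : {n : ℕ} → Vec (Fin n) n → Set
IsPerm w = Unique (toList w)

isPerm? : {n : ℕ} → (w : Vec (Fin n) n) → Dec (IsPerm w)
isPerm? w = UD.unique? FinP._≟_ (toList w)

Sn : (n : ℕ) → List (Vec (Fin n) n)
Sn n = filter isPerm? (allWords n n)

-- S^3_n : pairs (π², π³) of permutations
S3n : (n : ℕ) → List (Vec (Fin n) n × Vec (Fin n) n)
S3n n = cartesianProduct (Sn n) (Sn n)

levels : {n : ℕ} → Vec (Fin n) n × Vec (Fin n) n → List ℕ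
levels (p , q) = zipWith (λ a b → toℕ a + toℕ b) (toList p) (toList q)

-- a k-plateau at (1-based) position i = j+1, 0 ≤ j ≤ n-k:
-- the k consecutive levels starting at position i are all equal
IsPlateauAt : {n : ℕ} → ℕ → Vec (Fin n) n × Vec (Fin n) n → ℕ → Set
IsPlateauAt {n} k Π j with take k (drop j (levels Π))
... | [] = Data.Unit.⊤ where import Data.Unit
... | x ∷ xs = All (λ y → y ≡ x) xs

isPlateauAt? : {n : ℕ} (k : ℕ) (Π : Vec (Fin n) n × Vec (Fin n) n) (j : ℕ) → Dec (IsPlateauAt k Π j)
isPlateauAt? {n} k Π j with take k (drop j (levels Π))
... | [] = Relation.Nullary.yes Data.Unit.tt where import Data.Unit
... | x ∷ xs = all? (λ y → y ≟ x) xs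

-- number of k-plateaux of Π: indices j ∈ {0,…,n-k} (i.e. i = j+1 ∈ {1,…,n-k+1})
plateaux : {n : ℕ} → ℕ → Vec (Fin n) n × Vec (Fin n) n → ℕ
plateaux {n} k Π = length (filter (isPlateauAt? k Π) (upTo (n ∸ k + 1)))

totalPlateaux : ℕ → ℕ → ℕ
totalPlateaux n k = sum (map (plateaux k) (S3n n))

-- Σ_{ℓ = a}^{b} f ℓ  (empty if b < a)
sumFromTo : ℕ → ℕ → (ℕ → ℕ) → ℕ
sumFromTo a b f = sum (map (λ t → f (a + t)) (upTo (suc b ∸ a)))

formula : ℕ → ℕ → ℕ
formula n k =
  ((n ∸ k + 1) !) * ((n ∸ k) !) *
    ((n ! / (n ∸ k) !) {{(n ∸ k) !≢0}}
     + 2 * sumFromTo (k ∸ 1) (n ∸ 2)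
             (λ ℓ → ((ℓ + 1) ! / (ℓ + 1 ∸ k) !) {{(ℓ + 1 ∸ k) !≢0}}))

-- Count plateaux window by window.  Whether Π has a k-plateau at position j
-- only depends on the k columns of the window, and the n − k columns
-- outside it can be filled with the remaining values of π² and of π³ in
-- ((n − k)!)² ways; so each of the n − k + 1 windows contributes
-- ((n − k)!)² · D, where D counts the pairs (x, y) of injective k-words
-- over {0,…,n−1} with x_i + y_i constant.  For a fixed level s, y is
-- determined by x (y_i = s − x_i) and is injective exactly when x is, so
-- D = Σ_s (c_s)^(k) with x^(k) = x(x−1)⋯(x−k+1) and
-- c_s = min(s + 1, 2n − 1 − s) the number of a < n with a partner b < n,
-- a + b = s.  Summing over s gives n^(k) + 2 Σ_{t<n−1} (t + 1)^(k), and
-- x^(k) = x!/(x − k)! for x ≥ k while it vanishes for x < k.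

module Submission where

open import Defs
open import Data.Bool using (true; false; if_then_else_)
open import Data.Fin as Fin using (Fin; toℕ)
open import Data.Fin.Properties using (toℕ-injective; toℕ≤pred[n]) renaming (_≟_ to _≟ᶠ_)
open import Data.List using (List; []; _∷_; _++_; map; filter; length; upTo; applyUpTo; allFin; concatMap; cartesianProduct; take; drop; zipWith)
import Data.List.Properties as List
open import Data.List.Relation.Unary.All using (All; []; _∷_; all?; universal)
import Data.List.Relation.Unary.All.Properties as All
open import Data.List.Relation.Unary.AllPairs using ([]; _∷_)
open import Data.List.Relation.Unary.Unique.Propositional using (Unique)
import Data.List.Relation.Unary.Unique.DecPropositional as UniqueDec
import Data.List.Relation.Binary.Permutation.Setoid.Properties as Permutation
open import Data.Nat using (ℕ; zero; suc; _+_; _*_; _∸_; _≤_; _<_; _≤ᵇ_; _!; z≤n; s≤s; s≤s⁻¹)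
import Data.Nat.Combinatorics as Combinatorics
open import Data.Nat.Combinatorics.Base using (_P′_)
open import Data.Nat.DivMod using (_/_)
open import Data.Nat.ListAction using (sum)
open import Data.Nat.ListAction.Properties using (sum-++)
open import Data.Nat.Properties
open import Data.Nat.Tactic.RingSolver using (solve-∀)
open import Data.Product as Product using (_×_; _,_; proj₁)
open import Data.Unit using (⊤; tt)
open import Data.Vec as Vec using (Vec; toList)
import Data.Vec.Properties as Vec
open import Function using (_∘_; id)
open import Relation.Nullary using (Dec; yes; no; does; ¬?; _×-dec_; contradiction)
open import Relation.Unary using (Decidable)
open import Relation.Binary.PropositionalEquality using (_≡_; _≢_; refl; sym; trans; cong; cong₂; subst; setoid; module ≡-Reasoning)
import Algebra.Properties.CommutativeSemigroup as CommutativeSemigroupProperties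

module +-CS = CommutativeSemigroupProperties +-commutativeSemigroup
module *-CS = CommutativeSemigroupProperties *-commutativeSemigroup

-- Indicators and finite sums

⟦_⟧ : {P : Set} → Dec P → ℕ
⟦ d ⟧ = if does d then 1 else 0

⟦⟧-×-dec : {P Q : Set} (p : Dec P) (q : Dec Q) → ⟦ p ×-dec q ⟧ ≡ ⟦ p ⟧ * ⟦ q ⟧
⟦⟧-×-dec p q with does p | does q
... | true  | true  = refl
... | true  | false = refl
... | false | _     = refl

⟦⟧-idem : {P : Set} (p : Dec P) → ⟦ p ⟧ * ⟦ p ⟧ ≡ ⟦ p ⟧
⟦⟧-idem p with does p
... | true  = refl
... | false = refl

⟦⟧+⟦¬?⟧ : {P : Set} (p : Dec P) → ⟦ p ⟧ + ⟦ ¬? p ⟧ ≡ 1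
⟦⟧+⟦¬?⟧ p with does p
... | true  = refl
... | false = refl

⟦yes⟧ : {P : Set} (p : Dec P) → P → ⟦ p ⟧ ≡ 1
⟦yes⟧ (yes _) _  = refl
⟦yes⟧ (no ¬x) x  = contradiction x ¬x

⟦⟧-cong : {P Q : Set} (p : Dec P) (q : Dec Q) → (P → Q) → (Q → P) → ⟦ p ⟧ ≡ ⟦ q ⟧
⟦⟧-cong (yes x) q       P→Q _   = sym (⟦yes⟧ q (P→Q x))
⟦⟧-cong (no ¬x) (yes y) _   Q→P = contradiction (Q→P y) ¬x
⟦⟧-cong (no _)  (no _)  _   _   = refl

⟦⟧-*-congˡ : {P Q R : Set} (p : Dec P) (q : Dec Q) (r : Dec R) →
  (P → Q → R) → (P → R → Q) → ⟦ p ⟧ * ⟦ q ⟧ ≡ ⟦ p ⟧ * ⟦ r ⟧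
⟦⟧-*-congˡ (yes x) q r Q→R R→Q = cong (_+ 0) (⟦⟧-cong q r (Q→R x) (R→Q x))
⟦⟧-*-congˡ (no _)  q r _   _   = refl

module _ {A : Set} {P : A → Set} (P? : Decidable P) where

  ⟦all?⟧-∷ : (x : A) (xs : List A) → ⟦ all? P? (x ∷ xs) ⟧ ≡ ⟦ P? x ⟧ * ⟦ all? P? xs ⟧
  ⟦all?⟧-∷ x xs = ⟦⟧-×-dec (P? x) (all? P? xs)

infix 5 ∑ ∑<

∑ : {A : Set} → List A → (A → ℕ) → ℕ
∑ xs f = sum (map f xs)

syntax ∑ xs (λ x → e) = ∑[ x ∈ xs ] e

∑-cong : {A : Set} (xs : List A) {f g : A → ℕ} → (∀ x → f x ≡ g x) → ∑ xs f ≡ ∑ xs g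
∑-cong []       f≗g = refl
∑-cong (x ∷ xs) f≗g = cong₂ _+_ (f≗g x) (∑-cong xs f≗g)

∑-++ : {A : Set} (xs ys : List A) (f : A → ℕ) → ∑ (xs ++ ys) f ≡ ∑ xs f + ∑ ys f
∑-++ xs ys f = trans (cong sum (List.map-++ f xs ys)) (sum-++ (map f xs) (map f ys))

∑-+ : {A : Set} (xs : List A) (f g : A → ℕ) → (∑[ x ∈ xs ] f x + g x) ≡ ∑ xs f + ∑ xs g
∑-+ []       f g = refl
∑-+ (x ∷ xs) f g = trans (cong (f x + g x +_) (∑-+ xs f g)) (+-CS.interchange (f x) (g x) _ _)

∑-*ˡ : {A : Set} (xs : List A) (c : ℕ) (f : A → ℕ) → (∑[ x ∈ xs ] c * f x) ≡ c * ∑ xs f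
∑-*ˡ []       c f = sym (*-zeroʳ c)
∑-*ˡ (x ∷ xs) c f = trans (cong (c * f x +_) (∑-*ˡ xs c f)) (sym (*-distribˡ-+ c (f x) _))

∑-*ʳ : {A : Set} (xs : List A) (c : ℕ) (f : A → ℕ) → (∑[ x ∈ xs ] f x * c) ≡ ∑ xs f * c
∑-*ʳ xs c f = trans (∑-cong xs (λ x → *-comm (f x) c)) (trans (∑-*ˡ xs c f) (*-comm c _))

∑-zero : {A : Set} (xs : List A) → (∑[ x ∈ xs ] 0) ≡ 0
∑-zero []       = refl
∑-zero (x ∷ xs) = ∑-zero xs

∑-comm : {A B : Set} (xs : List A) (ys : List B) (f : A → B → ℕ) →
  (∑[ x ∈ xs ] ∑[ y ∈ ys ] f x y) ≡ (∑[ y ∈ ys ] ∑[ x ∈ xs ] f x y)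
∑-comm []       ys f = sym (∑-zero ys)
∑-comm (x ∷ xs) ys f = trans (cong (∑ ys (f x) +_) (∑-comm xs ys f)) (sym (∑-+ ys (f x) _))

∑-map : {A B : Set} (g : A → B) (xs : List A) (f : B → ℕ) → ∑ (map g xs) f ≡ ∑ xs (f ∘ g)
∑-map g []       f = refl
∑-map g (x ∷ xs) f = cong (f (g x) +_) (∑-map g xs f)

∑-concatMap : {A B : Set} (g : A → List B) (xs : List A) (f : B → ℕ) →
  ∑ (concatMap g xs) f ≡ (∑[ x ∈ xs ] ∑ (g x) f)
∑-concatMap g []       f = refl
∑-concatMap g (x ∷ xs) f = trans (∑-++ (g x) _ f) (cong (∑ (g x) f +_) (∑-concatMap g xs f))

∑-cartesianProduct : {A B : Set} (xs : List A) (ys : List B) (f : A × B → ℕ) →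
  ∑ (cartesianProduct xs ys) f ≡ (∑[ x ∈ xs ] ∑[ y ∈ ys ] f (x , y))
∑-cartesianProduct []       ys f = refl
∑-cartesianProduct (x ∷ xs) ys f =
  trans (∑-++ (map (x ,_) ys) _ f) (cong₂ _+_ (∑-map (x ,_) ys f) (∑-cartesianProduct xs ys f))

∑-filter : {A : Set} {P : A → Set} (P? : ∀ x → Dec (P x)) (xs : List A) (f : A → ℕ) →
  ∑ (filter P? xs) f ≡ (∑[ x ∈ xs ] ⟦ P? x ⟧ * f x)
∑-filter P? []       f = refl
∑-filter P? (x ∷ xs) f with does (P? x)
... | true  = cong₂ _+_ (sym (+-identityʳ (f x))) (∑-filter P? xs f)
... | false = ∑-filter P? xs f

length-filter : {A : Set} {P : A → Set} (P? : ∀ x → Dec (P x)) (xs : List A) →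
  length (filter P? xs) ≡ (∑[ x ∈ xs ] ⟦ P? x ⟧)
length-filter P? []       = refl
length-filter P? (x ∷ xs) with does (P? x)
... | true  = cong suc (length-filter P? xs)
... | false = length-filter P? xs

∑-allFin-suc : (n : ℕ) (f : Fin (suc n) → ℕ) → ∑ (allFin (suc n)) f ≡ f Fin.zero + ∑ (allFin n) (f ∘ Fin.suc)
∑-allFin-suc n f =
  cong (f Fin.zero +_) (cong sum (trans (List.map-tabulate Fin.suc f) (sym (List.map-tabulate id (f ∘ Fin.suc)))))

∑< : ℕ → (ℕ → ℕ) → ℕ
∑< zero    f = 0
∑< (suc N) f = f 0 + ∑< N (f ∘ suc)

syntax ∑< N (λ i → e) = ∑[ i < N ] e

∑<-cong : (N : ℕ) {f g : ℕ → ℕ} → (∀ i → i < N → f i ≡ g i) → ∑< N f ≡ ∑< N g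
∑<-cong zero    f≗g = refl
∑<-cong (suc N) f≗g = cong₂ _+_ (f≗g 0 (s≤s z≤n)) (∑<-cong N (λ i i<N → f≗g (suc i) (s≤s i<N)))

∑<-const : (N c : ℕ) → (∑[ i < N ] c) ≡ N * c
∑<-const zero    c = refl
∑<-const (suc N) c = cong (c +_) (∑<-const N c)

∑<-zero : (N : ℕ) → (∑[ i < N ] 0) ≡ 0
∑<-zero zero    = refl
∑<-zero (suc N) = ∑<-zero N

∑<-+ : (N M : ℕ) (f : ℕ → ℕ) → ∑< (N + M) f ≡ ∑< N f + (∑[ i < M ] f (N + i))
∑<-+ zero    M f = refl
∑<-+ (suc N) M f = trans (cong (f 0 +_) (∑<-+ N M (f ∘ suc))) (sym (+-assoc (f 0) _ _))

∑<-suc : (N : ℕ) (f : ℕ → ℕ) → ∑< (suc N) f ≡ ∑< N f + f N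
∑<-suc N f = begin
  ∑< (suc N) f               ≡⟨ cong (λ M → ∑< M f) (+-comm 1 N) ⟩
  ∑< (N + 1) f               ≡⟨ ∑<-+ N 1 f ⟩
  ∑< N f + (f (N + 0) + 0)   ≡⟨ cong (∑< N f +_) (trans (+-identityʳ _) (cong f (+-identityʳ N))) ⟩
  ∑< N f + f N               ∎
  where open ≡-Reasoning

∑<-reverse : (N : ℕ) (f : ℕ → ℕ) → (∑[ i < N ] f (N ∸ suc i)) ≡ ∑< N f
∑<-reverse zero    f = refl
∑<-reverse (suc N) f = trans (cong (f N +_) (∑<-reverse N f)) (trans (+-comm (f N) _) (sym (∑<-suc N f)))

∑-upTo : (N : ℕ) (f : ℕ → ℕ) → ∑ (upTo N) f ≡ ∑< N f
∑-upTo N = go N id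
  where
  go : (N : ℕ) (g f : ℕ → ℕ) → ∑ (applyUpTo g N) f ≡ ∑< N (f ∘ g)
  go zero    g f = refl
  go (suc N) g f = cong (f (g 0) +_) (go N (g ∘ suc) f)

∑-∑<-comm : {A : Set} (xs : List A) (N : ℕ) (f : A → ℕ → ℕ) →
  (∑[ x ∈ xs ] ∑[ i < N ] f x i) ≡ (∑[ i < N ] ∑[ x ∈ xs ] f x i)
∑-∑<-comm xs N f = begin
  (∑[ x ∈ xs ] ∑< N (f x))            ≡⟨ ∑-cong xs (λ x → sym (∑-upTo N (f x))) ⟩
  (∑[ x ∈ xs ] ∑ (upTo N) (f x))      ≡⟨ ∑-comm xs (upTo N) f ⟩
  (∑[ i ∈ upTo N ] ∑[ x ∈ xs ] f x i) ≡⟨ ∑-upTo N _ ⟩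
  (∑[ i < N ] ∑[ x ∈ xs ] f x i)      ∎
  where open ≡-Reasoning

∑<-*ˡ : (N c : ℕ) (f : ℕ → ℕ) → (∑[ i < N ] c * f i) ≡ c * ∑< N f
∑<-*ˡ N c f = trans (sym (∑-upTo N _)) (trans (∑-*ˡ (upTo N) c f) (cong (c *_) (∑-upTo N f)))

∑-allFin-toℕ : (n : ℕ) (f : ℕ → ℕ) → (∑[ a ∈ allFin n ] f (toℕ a)) ≡ ∑< n f
∑-allFin-toℕ zero    f = refl
∑-allFin-toℕ (suc n) f = trans (∑-allFin-suc n (f ∘ toℕ)) (cong (f 0 +_) (∑-allFin-toℕ n (f ∘ suc)))

∑-allFin-≟ : {n : ℕ} (x : Fin n) (f : Fin n → ℕ) → (∑[ a ∈ allFin n ] ⟦ a ≟ᶠ x ⟧ * f a) ≡ f x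
∑-allFin-≟ {suc n} Fin.zero f = begin
  ∑ (allFin (suc n)) (λ a → ⟦ a ≟ᶠ Fin.zero ⟧ * f a) ≡⟨ ∑-allFin-suc n (λ a → ⟦ a ≟ᶠ Fin.zero ⟧ * f a) ⟩
  f Fin.zero + 0 + (∑[ a ∈ allFin n ] 0)              ≡⟨ cong (f Fin.zero + 0 +_) (∑-zero (allFin n)) ⟩
  f Fin.zero + 0 + 0                                 ≡⟨ trans (+-identityʳ _) (+-identityʳ _) ⟩
  f Fin.zero                                         ∎
  where open ≡-Reasoning
∑-allFin-≟ {suc n} (Fin.suc x) f =
  trans (∑-allFin-suc n (λ a → ⟦ a ≟ᶠ Fin.suc x ⟧ * f a)) (∑-allFin-≟ x (f ∘ Fin.suc))

∑-allFin-split : {n : ℕ} (x : Fin n) (f : Fin n → ℕ) →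
  ∑ (allFin n) f ≡ f x + (∑[ a ∈ allFin n ] ⟦ ¬? (a ≟ᶠ x) ⟧ * f a)
∑-allFin-split {n} x f = begin
  ∑ (allFin n) f                                           ≡⟨ ∑-cong (allFin n) split ⟩
  (∑[ a ∈ allFin n ] ⟦ a ≟ᶠ x ⟧ * f a + ⟦ ¬? (a ≟ᶠ x) ⟧ * f a) ≡⟨ ∑-+ (allFin n) _ _ ⟩
  (∑[ a ∈ allFin n ] ⟦ a ≟ᶠ x ⟧ * f a) + others             ≡⟨ cong (_+ others) (∑-allFin-≟ x f) ⟩
  f x + others                                             ∎
  where
  open ≡-Reasoning
  others = ∑[ a ∈ allFin n ] ⟦ ¬? (a ≟ᶠ x) ⟧ * f a
  split : ∀ a → f a ≡ ⟦ a ≟ᶠ x ⟧ * f a + ⟦ ¬? (a ≟ᶠ x) ⟧ * f a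
  split a = begin
    f a                                             ≡⟨ *-identityˡ (f a) ⟨
    1 * f a                                         ≡⟨ cong (_* f a) (⟦⟧+⟦¬?⟧ (a ≟ᶠ x)) ⟨
    (⟦ a ≟ᶠ x ⟧ + ⟦ ¬? (a ≟ᶠ x) ⟧) * f a              ≡⟨ *-distribʳ-+ (f a) ⟦ a ≟ᶠ x ⟧ _ ⟩
    ⟦ a ≟ᶠ x ⟧ * f a + ⟦ ¬? (a ≟ᶠ x) ⟧ * f a         ∎

-- Falling factorials

-- `_P′_` is documented for k ≤ n only, but it is the falling factorial
-- for every k: beyond k = n it picks up the factor n ∸ n = 0.
P′-+ : ∀ x a b → x P′ (a + b) ≡ (x P′ a) * ((x ∸ a) P′ b)
P′-+ x a zero    = trans (cong (x P′_) (+-identityʳ a)) (sym (*-identityʳ (x P′ a)))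
P′-+ x a (suc b) = begin
  x P′ (a + suc b)                            ≡⟨ cong (x P′_) (+-suc a b) ⟩
  (x ∸ (a + b)) * (x P′ (a + b))              ≡⟨ cong₂ _*_ (∸-+-assoc x a b) (sym (P′-+ x a b)) ⟨
  (x ∸ a ∸ b) * ((x P′ a) * ((x ∸ a) P′ b))   ≡⟨ *-CS.x∙yz≈y∙xz (x ∸ a ∸ b) (x P′ a) _ ⟩
  (x P′ a) * ((x ∸ a) P′ suc b)               ∎
  where open ≡-Reasoning

P′≡P : ∀ {n k} → k ≤ n → n P′ k ≡ n Combinatorics.P k
P′≡P {n} {k} k≤n with k ≤ᵇ n | ≤⇒≤ᵇ k≤n
... | true | _ = refl

P′-self : ∀ n → n P′ n ≡ n !
P′-self n = trans (P′≡P (≤-refl {n})) (Combinatorics.nPn≡n! n)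

P′≡!/! : ∀ {n k} → k ≤ n → n P′ k ≡ (n ! / (n ∸ k) !) {{(n ∸ k) !≢0}}
P′≡!/! k≤n = trans (P′≡P k≤n) (Combinatorics.nPk≡n!/[n∸k]! k≤n)

P′-vanishes : ∀ {n k} → n < k → n P′ k ≡ 0
P′-vanishes {n} {suc k} (s≤s n≤k) = cong (_* (n P′ k)) (m≤n⇒m∸n≡0 n≤k)

-- Injective words

module _ {n : ℕ} where

  unique? : (xs : List (Fin n)) → Dec (Unique xs)
  unique? = UniqueDec.unique? _≟ᶠ_

  fresh? : (a : Fin n) (xs : List (Fin n)) → Dec (All (a ≢_) xs)
  fresh? a = all? (λ x → ¬? (a ≟ᶠ x))

  ⟦unique?⟧-∷ : (a : Fin n) (xs : List (Fin n)) → ⟦ unique? (a ∷ xs) ⟧ ≡ ⟦ fresh? a xs ⟧ * ⟦ unique? xs ⟧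
  ⟦unique?⟧-∷ a xs = ⟦⟧-×-dec (fresh? a xs) (unique? xs)

  ⟦unique?⟧-++-comm : (xs ys : List (Fin n)) → ⟦ unique? (xs ++ ys) ⟧ ≡ ⟦ unique? (ys ++ xs) ⟧
  ⟦unique?⟧-++-comm xs ys = ⟦⟧-cong (unique? (xs ++ ys)) (unique? (ys ++ xs))
    (Unique-resp-↭ (++-comm xs ys)) (Unique-resp-↭ (++-comm ys xs))
    where open Permutation (setoid (Fin n)) using (Unique-resp-↭; ++-comm)

  count : {P : Fin n → Set} → Decidable P → ℕ
  count P? = ∑[ a ∈ allFin n ] ⟦ P? a ⟧

∑-allWords-suc : (n m : ℕ) (f : Vec (Fin n) (suc m) → ℕ) →
  ∑ (allWords n (suc m)) f ≡ (∑[ w ∈ allWords n m ] ∑[ a ∈ allFin n ] f (a Vec.∷ w))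
∑-allWords-suc n m f =
  trans (∑-concatMap _ (allWords n m) f) (∑-cong (allWords n m) (λ w → ∑-map (Vec._∷ w) (allFin n) f))

∑-allWords-++ : (n a b : ℕ) (f : Vec (Fin n) (a + b) → ℕ) →
  ∑ (allWords n (a + b)) f ≡ (∑[ u ∈ allWords n a ] ∑[ w ∈ allWords n b ] f (u Vec.++ w))
∑-allWords-++ n zero    b f = sym (+-identityʳ _)
∑-allWords-++ n (suc a) b f = begin
  ∑ (allWords n (suc a + b)) f
    ≡⟨ ∑-allWords-suc n (a + b) f ⟩
  (∑[ v ∈ allWords n (a + b) ] ∑[ c ∈ allFin n ] f (c Vec.∷ v))
    ≡⟨ ∑-allWords-++ n a b _ ⟩
  (∑[ u ∈ allWords n a ] ∑[ w ∈ allWords n b ] ∑[ c ∈ allFin n ] f (c Vec.∷ u Vec.++ w))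
    ≡⟨ ∑-cong (allWords n a) (λ u → ∑-comm (allWords n b) (allFin n) _) ⟩
  (∑[ u ∈ allWords n a ] ∑[ c ∈ allFin n ] ∑[ w ∈ allWords n b ] f (c Vec.∷ u Vec.++ w))
    ≡⟨ ∑-allWords-suc n a _ ⟨
  (∑[ u ∈ allWords n (suc a) ] ∑[ w ∈ allWords n b ] f (u Vec.++ w)) ∎
  where open ≡-Reasoning

module _ {n : ℕ} {P : Fin n → Set} (P? : Decidable P) where

  count-fresh : (xs : List (Fin n)) → All P xs → Unique xs →
    (∑[ a ∈ allFin n ] ⟦ P? a ⟧ * ⟦ fresh? a xs ⟧) + length xs ≡ count P?
  count-fresh [] [] [] = trans (+-identityʳ _) (∑-cong (allFin n) (λ a → *-identityʳ ⟦ P? a ⟧))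
  count-fresh (x ∷ xs) (px ∷ pxs) (x∉xs ∷ !xs) = begin
    (∑[ a ∈ allFin n ] ⟦ P? a ⟧ * ⟦ fresh? a (x ∷ xs) ⟧) + suc (length xs)
      ≡⟨ cong (_+ suc (length xs)) (∑-cong (allFin n) step) ⟩
    others + suc (length xs)
      ≡⟨ +-suc others (length xs) ⟩
    suc others + length xs
      ≡⟨ cong (λ k → k + others + length xs) gx≡1 ⟨
    g x + others + length xs
      ≡⟨ cong (_+ length xs) (∑-allFin-split x g) ⟨
    ∑ (allFin n) g + length xs
      ≡⟨ count-fresh xs pxs !xs ⟩
    count P? ∎
    where
    open ≡-Reasoning
    g : Fin n → ℕ
    g a = ⟦ P? a ⟧ * ⟦ fresh? a xs ⟧
    others : ℕ
    others = ∑[ a ∈ allFin n ] ⟦ ¬? (a ≟ᶠ x) ⟧ * g a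
    gx≡1 : g x ≡ 1
    gx≡1 = cong₂ _*_ (⟦yes⟧ (P? x) px) (⟦yes⟧ (fresh? x xs) x∉xs)
    step : ∀ a → ⟦ P? a ⟧ * ⟦ fresh? a (x ∷ xs) ⟧ ≡ ⟦ ¬? (a ≟ᶠ x) ⟧ * g a
    step a = trans (cong (⟦ P? a ⟧ *_) (⟦all?⟧-∷ (λ y → ¬? (a ≟ᶠ y)) x xs))
                   (*-CS.x∙yz≈y∙xz ⟦ P? a ⟧ ⟦ ¬? (a ≟ᶠ x) ⟧ ⟦ fresh? a xs ⟧)

  count-unique-prefixes-in : (ys : List (Fin n)) → All P ys → (m : ℕ) →
    (∑[ v ∈ allWords n m ] ⟦ all? P? (toList v) ⟧ * ⟦ unique? (toList v ++ ys) ⟧)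
      ≡ ⟦ unique? ys ⟧ * ((count P? ∸ length ys) P′ m)
  count-unique-prefixes-in ys pys zero = trans (+-identityʳ _) (trans (+-identityʳ _) (sym (*-identityʳ ⟦ unique? ys ⟧)))
  count-unique-prefixes-in ys pys (suc m) = begin
    ∑ (allWords n (suc m)) F
      ≡⟨ ∑-allWords-suc n m F ⟩
    (∑[ w ∈ allWords n m ] ∑[ a ∈ allFin n ] F (a Vec.∷ w))
      ≡⟨ ∑-cong (allWords n m) extend ⟩
    (∑[ w ∈ allWords n m ] F w * K)
      ≡⟨ ∑-*ʳ (allWords n m) K F ⟩
    ∑ (allWords n m) F * K
      ≡⟨ cong (_* K) (count-unique-prefixes-in ys pys m) ⟩
    ⟦ unique? ys ⟧ * ((c ∸ l) P′ m) * K
      ≡⟨ cong (⟦ unique? ys ⟧ * ((c ∸ l) P′ m) *_) (∸-+-assoc c l m) ⟨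
    ⟦ unique? ys ⟧ * ((c ∸ l) P′ m) * (c ∸ l ∸ m)
      ≡⟨ *-CS.xy∙z≈x∙zy ⟦ unique? ys ⟧ _ _ ⟩
    ⟦ unique? ys ⟧ * ((c ∸ l) P′ suc m) ∎
    where
    open ≡-Reasoning
    c = count P?
    l = length ys
    K = c ∸ (l + m)
    F : {i : ℕ} → Vec (Fin n) i → ℕ
    F v = ⟦ all? P? (toList v) ⟧ * ⟦ unique? (toList v ++ ys) ⟧
    fresh-count : (w : Vec (Fin n) m) →
      F w * (∑[ a ∈ allFin n ] ⟦ P? a ⟧ * ⟦ fresh? a (toList w ++ ys) ⟧) ≡ F w * K
    fresh-count w with all? P? (toList w) | unique? (toList w ++ ys)
    ... | yes w✓ | yes !w++ys = cong (1 *_) (begin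
      fresh                                    ≡⟨ m+n∸n≡m fresh (length (toList w ++ ys)) ⟨
      fresh + length (toList w ++ ys) ∸ length (toList w ++ ys)
        ≡⟨ cong₂ _∸_ (count-fresh (toList w ++ ys) (All.++⁺ w✓ pys) !w++ys) length-w++ys ⟩
      K                                        ∎)
      where
      fresh = ∑[ a ∈ allFin n ] ⟦ P? a ⟧ * ⟦ fresh? a (toList w ++ ys) ⟧
      length-w++ys : length (toList w ++ ys) ≡ l + m
      length-w++ys = trans (List.length-++ (toList w)) (trans (cong (_+ l) (Vec.length-toList w)) (+-comm m l))
    ... | yes _ | no _ = refl
    ... | no _  | _    = refl
    extend : (w : Vec (Fin n) m) → (∑[ a ∈ allFin n ] F (a Vec.∷ w)) ≡ F w * K
    extend w = begin
      (∑[ a ∈ allFin n ] F (a Vec.∷ w))                                    ≡⟨ ∑-cong (allFin n) split ⟩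
      (∑[ a ∈ allFin n ] F w * (⟦ P? a ⟧ * ⟦ fresh? a (toList w ++ ys) ⟧)) ≡⟨ ∑-*ˡ (allFin n) (F w) _ ⟩
      F w * (∑[ a ∈ allFin n ] ⟦ P? a ⟧ * ⟦ fresh? a (toList w ++ ys) ⟧)   ≡⟨ fresh-count w ⟩
      F w * K                                                              ∎
      where
      split : ∀ a → F (a Vec.∷ w) ≡ F w * (⟦ P? a ⟧ * ⟦ fresh? a (toList w ++ ys) ⟧)
      split a = begin
        F (a Vec.∷ w)
          ≡⟨ cong₂ _*_ (⟦all?⟧-∷ P? a (toList w)) (⟦unique?⟧-∷ a (toList w ++ ys)) ⟩
        ⟦ P? a ⟧ * ⟦ all? P? (toList w) ⟧ * (⟦ fresh? a (toList w ++ ys) ⟧ * ⟦ unique? (toList w ++ ys) ⟧)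
          ≡⟨ *-CS.interchange ⟦ P? a ⟧ _ _ _ ⟩
        ⟦ P? a ⟧ * ⟦ fresh? a (toList w ++ ys) ⟧ * F w
          ≡⟨ *-comm _ (F w) ⟩
        F w * (⟦ P? a ⟧ * ⟦ fresh? a (toList w ++ ys) ⟧)
          ∎

count-unique-prefixes : {n : ℕ} (ys : List (Fin n)) (m : ℕ) →
  (∑[ v ∈ allWords n m ] ⟦ unique? (toList v ++ ys) ⟧) ≡ ⟦ unique? ys ⟧ * ((n ∸ length ys) P′ m)
count-unique-prefixes {n} ys m = begin
  (∑[ v ∈ allWords n m ] ⟦ unique? (toList v ++ ys) ⟧)
    ≡⟨ ∑-cong (allWords n m) everywhere ⟩
  (∑[ v ∈ allWords n m ] ⟦ all? U? (toList v) ⟧ * ⟦ unique? (toList v ++ ys) ⟧)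
    ≡⟨ count-unique-prefixes-in U? ys (universal _ ys) m ⟩
  ⟦ unique? ys ⟧ * ((count U? ∸ length ys) P′ m)
    ≡⟨ cong (λ k → ⟦ unique? ys ⟧ * ((k ∸ length ys) P′ m)) count-U ⟩
  ⟦ unique? ys ⟧ * ((n ∸ length ys) P′ m) ∎
  where
  open ≡-Reasoning
  U? : Decidable {A = Fin n} (λ _ → ⊤)
  U? _ = yes tt
  everywhere : (v : Vec (Fin n) m) →
    ⟦ unique? (toList v ++ ys) ⟧ ≡ ⟦ all? U? (toList v) ⟧ * ⟦ unique? (toList v ++ ys) ⟧
  everywhere v = sym (trans (cong (_* ⟦ unique? (toList v ++ ys) ⟧) (⟦yes⟧ (all? U? (toList v)) (universal _ (toList v))))
                            (*-identityˡ _))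
  count-U : count U? ≡ n
  count-U = trans (∑-allFin-toℕ n (λ _ → 1)) (trans (∑<-const n 1) (*-identityʳ n))

-- Windows

module _ {A : Set} where

  take-toList-++ : {k : ℕ} (t : Vec A k) (ys : List A) → take k (toList t ++ ys) ≡ toList t
  take-toList-++ Vec.[]       ys = refl
  take-toList-++ (x Vec.∷ t) ys = cong (x ∷_) (take-toList-++ t ys)

  take-drop-toList-++ : {j k : ℕ} (u : Vec A j) (t : Vec A k) (ys : List A) →
    take k (drop j (toList u ++ (toList t ++ ys))) ≡ toList t
  take-drop-toList-++ Vec.[]      t ys = take-toList-++ t ys
  take-drop-toList-++ (_ Vec.∷ u) t ys = take-drop-toList-++ u t ys

module _ {A B C : Set} (f : A → B → C) where

  take-zipWith : ∀ k xs ys → take k (zipWith f xs ys) ≡ zipWith f (take k xs) (take k ys)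
  take-zipWith zero    xs       ys       = refl
  take-zipWith (suc k) []       ys       = refl
  take-zipWith (suc k) (x ∷ xs) []       = refl
  take-zipWith (suc k) (x ∷ xs) (y ∷ ys) = cong (f x y ∷_) (take-zipWith k xs ys)

  drop-zipWith : ∀ j xs ys → drop j (zipWith f xs ys) ≡ zipWith f (drop j xs) (drop j ys)
  drop-zipWith zero    xs       ys       = refl
  drop-zipWith (suc j) []       ys       = refl
  drop-zipWith (suc j) (x ∷ xs) []       = sym (List.zipWith-zeroʳ f (drop j xs))
  drop-zipWith (suc j) (x ∷ xs) (y ∷ ys) = drop-zipWith j xs ys

count-unique-around : {n : ℕ} (j r : ℕ) (ts : List (Fin n)) →
  (∑[ u ∈ allWords n j ] ∑[ w ∈ allWords n r ] ⟦ unique? (toList u ++ (ts ++ toList w)) ⟧)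
    ≡ ⟦ unique? ts ⟧ * ((n ∸ length ts) P′ (r + j))
count-unique-around {n} j r ts = begin
  (∑[ u ∈ Wj ] ∑[ w ∈ Wr ] ⟦ unique? (toList u ++ (ts ++ toList w)) ⟧)
    ≡⟨ ∑-comm Wj Wr _ ⟩
  (∑[ w ∈ Wr ] ∑[ u ∈ Wj ] ⟦ unique? (toList u ++ (ts ++ toList w)) ⟧)
    ≡⟨ ∑-cong Wr (λ w → count-unique-prefixes (ts ++ toList w) j) ⟩
  (∑[ w ∈ Wr ] ⟦ unique? (ts ++ toList w) ⟧ * ((n ∸ length (ts ++ toList w)) P′ j))
    ≡⟨ ∑-cong Wr (λ w → cong₂ (λ a b → a * ((n ∸ b) P′ j)) (⟦unique?⟧-++-comm ts (toList w)) (length-ts++w w)) ⟩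
  (∑[ w ∈ Wr ] ⟦ unique? (toList w ++ ts) ⟧ * ((n ∸ (l + r)) P′ j))
    ≡⟨ ∑-*ʳ Wr _ _ ⟩
  (∑[ w ∈ Wr ] ⟦ unique? (toList w ++ ts) ⟧) * ((n ∸ (l + r)) P′ j)
    ≡⟨ cong₂ _*_ (count-unique-prefixes ts r) (cong (_P′ j) (sym (∸-+-assoc n l r))) ⟩
  ⟦ unique? ts ⟧ * ((n ∸ l) P′ r) * ((n ∸ l ∸ r) P′ j)
    ≡⟨ *-assoc ⟦ unique? ts ⟧ _ _ ⟩
  ⟦ unique? ts ⟧ * (((n ∸ l) P′ r) * ((n ∸ l ∸ r) P′ j))
    ≡⟨ cong (⟦ unique? ts ⟧ *_) (P′-+ (n ∸ l) r j) ⟨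
  ⟦ unique? ts ⟧ * ((n ∸ l) P′ (r + j)) ∎
  where
  open ≡-Reasoning
  Wj = allWords n j
  Wr = allWords n r
  l = length ts
  length-ts++w : (w : Vec (Fin n) r) → length (ts ++ toList w) ≡ l + r
  length-ts++w w = trans (List.length-++ ts) (cong (l +_) (Vec.length-toList w))

∑-window : {n : ℕ} (j k r : ℕ) (F : List (Fin n) → ℕ) →
  (∑[ p ∈ allWords n (j + (k + r)) ] ⟦ unique? (toList p) ⟧ * F (take k (drop j (toList p))))
    ≡ ((n ∸ k) P′ (r + j)) * (∑[ t ∈ allWords n k ] ⟦ unique? (toList t) ⟧ * F (toList t))
∑-window {n} j k r F = begin
  ∑ (allWords n (j + (k + r))) G
    ≡⟨ ∑-allWords-++ n j (k + r) G ⟩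
  (∑[ u ∈ Wj ] ∑[ v ∈ allWords n (k + r) ] G (u Vec.++ v))
    ≡⟨ ∑-cong Wj (λ u → ∑-allWords-++ n k r _) ⟩
  (∑[ u ∈ Wj ] ∑[ t ∈ Wk ] ∑[ w ∈ Wr ] G (u Vec.++ (t Vec.++ w)))
    ≡⟨ ∑-cong Wj (λ u → ∑-cong Wk (λ t → ∑-cong Wr (λ w → split u t w))) ⟩
  (∑[ u ∈ Wj ] ∑[ t ∈ Wk ] ∑[ w ∈ Wr ] U u t w * F (toList t))
    ≡⟨ ∑-comm Wj Wk _ ⟩
  (∑[ t ∈ Wk ] ∑[ u ∈ Wj ] ∑[ w ∈ Wr ] U u t w * F (toList t))
    ≡⟨ ∑-cong Wk (λ t → trans (∑-cong Wj (λ u → ∑-*ʳ Wr _ _)) (∑-*ʳ Wj _ _)) ⟩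
  (∑[ t ∈ Wk ] (∑[ u ∈ Wj ] ∑[ w ∈ Wr ] U u t w) * F (toList t))
    ≡⟨ ∑-cong Wk (λ t → cong (_* F (toList t)) (around t)) ⟩
  (∑[ t ∈ Wk ] ⟦ unique? (toList t) ⟧ * R * F (toList t))
    ≡⟨ ∑-cong Wk (λ t → *-CS.xy∙z≈y∙xz ⟦ unique? (toList t) ⟧ R _) ⟩
  (∑[ t ∈ Wk ] R * (⟦ unique? (toList t) ⟧ * F (toList t)))
    ≡⟨ ∑-*ˡ Wk R _ ⟩
  R * (∑[ t ∈ Wk ] ⟦ unique? (toList t) ⟧ * F (toList t)) ∎
  where
  open ≡-Reasoning
  Wj = allWords n j
  Wk = allWords n k
  Wr = allWords n r
  R = (n ∸ k) P′ (r + j)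
  G : Vec (Fin n) (j + (k + r)) → ℕ
  G p = ⟦ unique? (toList p) ⟧ * F (take k (drop j (toList p)))
  U : Vec (Fin n) j → Vec (Fin n) k → Vec (Fin n) r → ℕ
  U u t w = ⟦ unique? (toList u ++ (toList t ++ toList w)) ⟧
  split : ∀ u t w → G (u Vec.++ (t Vec.++ w)) ≡ U u t w * F (toList t)
  split u t w rewrite Vec.toList-++ u (t Vec.++ w) | Vec.toList-++ t w =
    cong (U u t w *_) (cong F (take-drop-toList-++ u t (toList w)))
  around : ∀ t → (∑[ u ∈ Wj ] ∑[ w ∈ Wr ] U u t w) ≡ ⟦ unique? (toList t) ⟧ * R
  around t = trans (count-unique-around j r (toList t))
    (cong (λ l → ⟦ unique? (toList t) ⟧ * ((n ∸ l) P′ (r + j))) (Vec.length-toList t))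

-- Levels

∑<-≟ : (N x : ℕ) (f : ℕ → ℕ) → x < N → (∑[ i < N ] ⟦ x ≟ i ⟧ * f i) ≡ f x
∑<-≟ (suc N) zero    f _         = trans (cong (f 0 + 0 +_) (∑<-zero N)) (trans (+-identityʳ _) (+-identityʳ _))
∑<-≟ (suc N) (suc x) f (s≤s x<N) = ∑<-≟ N x (f ∘ suc) x<N

∑<-+≟ : (N x s : ℕ) → (∑[ y < N ] ⟦ x + y ≟ s ⟧) ≡ ⟦ x ≤? s ×-dec s <? x + N ⟧
∑<-+≟ zero    zero    s       = refl
∑<-+≟ (suc N) zero    zero    = cong suc (∑<-zero N)
∑<-+≟ (suc N) zero    (suc s) = ∑<-+≟ N zero s
∑<-+≟ N       (suc x) zero    = ∑<-zero N
∑<-+≟ N       (suc x) (suc s) = trans (∑<-+≟ N x s)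
  (⟦⟧-cong (x ≤? s ×-dec s <? x + N) (suc x ≤? suc s ×-dec suc s <? suc x + N)
    (Product.map s≤s s≤s) (Product.map s≤s⁻¹ s≤s⁻¹))

-- Not definitional: `_≤ᵇ_` only computes once its first argument is a
-- constructor.
⟦≤?⟧-suc : (x y : ℕ) → ⟦ suc x ≤? suc y ⟧ ≡ ⟦ x ≤? y ⟧
⟦≤?⟧-suc zero    y = refl
⟦≤?⟧-suc (suc x) y = refl

∑<-≤? : (N s : ℕ) → s < N → (∑[ x < N ] ⟦ x ≤? s ⟧) ≡ suc s
∑<-≤? (suc N) zero    _         = cong suc (∑<-zero N)
∑<-≤? (suc N) (suc s) (s≤s s<N) = cong suc (trans (∑<-cong N (λ x _ → ⟦≤?⟧-suc x s)) (∑<-≤? N s s<N))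

∑<-≥? : (N t : ℕ) → t ≤ N → (∑[ x < N ] ⟦ t ≤? x ⟧) + t ≡ N
∑<-≥? N       zero    _         = trans (+-identityʳ _) (trans (∑<-const N 1) (*-identityʳ N))
∑<-≥? (suc N) (suc t) (s≤s t≤N) =
  trans (+-suc _ t) (cong suc (trans (cong (_+ t) (∑<-cong N (λ x _ → ⟦≤?⟧-suc t x))) (∑<-≥? N t t≤N)))

level : {n : ℕ} → Fin n → Fin n → ℕ
level a b = toℕ a + toℕ b

constant : List ℕ → ℕ
constant []       = 1
constant (x ∷ xs) = ⟦ all? (_≟ x) xs ⟧

constant-∑ : (N x : ℕ) (xs : List ℕ) → x < N → constant (x ∷ xs) ≡ (∑[ s < N ] ⟦ all? (_≟ s) (x ∷ xs) ⟧)
constant-∑ N x xs x<N =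
  sym (trans (∑<-cong N (λ s _ → ⟦all?⟧-∷ (_≟ s) x xs)) (∑<-≟ N x (λ s → ⟦ all? (_≟ s) xs ⟧) x<N))

-- `HasPartner n s x` holds iff some y < n has x + y ≡ s.
HasPartner : ℕ → ℕ → ℕ → Set
HasPartner n s x = x ≤ s × s < x + n

hasPartner? : {n : ℕ} (s : ℕ) (a : Fin n) → Dec (HasPartner n s (toℕ a))
hasPartner? {n} s a = toℕ a ≤? s ×-dec s <? toℕ a + n

∑-partners : {n : ℕ} (s : ℕ) (a : Fin n) → (∑[ b ∈ allFin n ] ⟦ level a b ≟ s ⟧) ≡ ⟦ hasPartner? s a ⟧
∑-partners {n} s a = trans (∑-allFin-toℕ n (λ y → ⟦ toℕ a + y ≟ s ⟧)) (∑<-+≟ n (toℕ a) s)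

count-hasPartner-below : {n s : ℕ} → s < n → count (hasPartner? {n} s) ≡ suc s
count-hasPartner-below {n} {s} s<n = begin
  count (hasPartner? {n} s)                ≡⟨ ∑-allFin-toℕ n (λ x → ⟦ partner? x ⟧) ⟩
  (∑[ x < n ] ⟦ partner? x ⟧)              ≡⟨ ∑<-cong n (λ x _ → ⟦⟧-cong (partner? x) (x ≤? s) proj₁ (reaches x)) ⟩
  (∑[ x < n ] ⟦ x ≤? s ⟧)                  ≡⟨ ∑<-≤? n s s<n ⟩
  suc s                                    ∎
  where
  open ≡-Reasoning
  partner? : (x : ℕ) → Dec (HasPartner n s x)
  partner? x = x ≤? s ×-dec s <? x + n
  reaches : ∀ x → x ≤ s → HasPartner n s x
  reaches x x≤s = x≤s , ≤-trans s<n (m≤n+m n x)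

count-hasPartner-above : {n′ t : ℕ} → t < n′ → count (hasPartner? {suc n′} (suc n′ + t)) ≡ n′ ∸ t
count-hasPartner-above {n′} {t} t<n′ = begin
  count (hasPartner? {n} (n + t))
    ≡⟨ ∑-allFin-toℕ n (λ x → ⟦ partner? x ⟧) ⟩
  (∑[ x < n ] ⟦ partner? x ⟧)
    ≡⟨ ∑<-cong n (λ x x<n → ⟦⟧-cong (partner? x) (suc t ≤? x) (above x) (reaches x x<n)) ⟩
  (∑[ x < n ] ⟦ suc t ≤? x ⟧)
    ≡⟨ m+n∸n≡m _ (suc t) ⟨
  (∑[ x < n ] ⟦ suc t ≤? x ⟧) + suc t ∸ suc t
    ≡⟨ cong (_∸ suc t) (∑<-≥? n (suc t) (s≤s (<⇒≤ t<n′))) ⟩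
  n′ ∸ t ∎
  where
  open ≡-Reasoning
  n = suc n′
  partner? : (x : ℕ) → Dec (HasPartner n (n + t) x)
  partner? x = x ≤? n + t ×-dec n + t <? x + n
  above : ∀ x → HasPartner n (n + t) x → t < x
  above x (_ , n+t<x+n) = +-cancelˡ-< n t x (subst (n + t <_) (+-comm x n) n+t<x+n)
  reaches : ∀ x → x < n → t < x → HasPartner n (n + t) x
  reaches x x<n t<x = ≤-trans (<⇒≤ x<n) (m≤m+n n t) , subst (n + t <_) (+-comm n x) (+-monoʳ-< n t<x)

∑-levels : (n′ k : ℕ) →
  (∑[ s < suc n′ + n′ ] (count (hasPartner? {suc n′} s)) P′ k)
    ≡ (suc n′) P′ k + 2 * (∑[ t < n′ ] (suc t) P′ k)
∑-levels n′ k = begin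
  ∑< (suc n′ + n′) g                                  ≡⟨ ∑<-+ (suc n′) n′ g ⟩
  ∑< (suc n′) g + (∑[ t < n′ ] g (suc n′ + t))        ≡⟨ cong₂ _+_ (∑<-cong (suc n′) below) (∑<-cong n′ above) ⟩
  ∑< (suc n′) h + (∑[ t < n′ ] h (n′ ∸ suc t))        ≡⟨ cong₂ _+_ (∑<-suc n′ h) (∑<-reverse n′ h) ⟩
  ∑< n′ h + h n′ + ∑< n′ h                            ≡⟨ rearrange (∑< n′ h) (h n′) ⟩
  h n′ + 2 * ∑< n′ h                                  ∎
  where
  open ≡-Reasoning
  g h : ℕ → ℕ
  g s = (count (hasPartner? {suc n′} s)) P′ k
  h x = (suc x) P′ k
  below : ∀ s → s < suc n′ → g s ≡ h s
  below s s<n = cong (_P′ k) (count-hasPartner-below s<n)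
  above : ∀ t → t < n′ → g (suc n′ + t) ≡ h (n′ ∸ suc t)
  above t t<n′ = cong (_P′ k) (trans (count-hasPartner-above t<n′) (+-∸-assoc 1 t<n′))
  rearrange : ∀ a b → a + b + a ≡ b + 2 * a
  rearrange = solve-∀

module _ {n s : ℕ} {a b : Fin n} (ab≡s : level a b ≡ s) where

  fresh-partner : {k : ℕ} (as bs : Vec (Fin n) k) → All (_≡ s) (zipWith level (toList as) (toList bs)) →
    All (b ≢_) (toList bs) → All (a ≢_) (toList as)
  fresh-partner Vec.[]         Vec.[]         []               []              = []
  fresh-partner (a′ Vec.∷ as) (b′ Vec.∷ bs) (a′b′≡s ∷ levels) (b≢b′ ∷ b∉bs) =
    (λ { refl → b≢b′ (toℕ-injective (+-cancelˡ-≡ (toℕ a) (toℕ b) (toℕ b′) (trans ab≡s (sym a′b′≡s)))) })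
    ∷ fresh-partner as bs levels b∉bs

  fresh-partner⁻¹ : {k : ℕ} (as bs : Vec (Fin n) k) → All (_≡ s) (zipWith level (toList as) (toList bs)) →
    All (a ≢_) (toList as) → All (b ≢_) (toList bs)
  fresh-partner⁻¹ Vec.[]         Vec.[]         []               []              = []
  fresh-partner⁻¹ (a′ Vec.∷ as) (b′ Vec.∷ bs) (a′b′≡s ∷ levels) (a≢a′ ∷ a∉as) =
    (λ { refl → a≢a′ (toℕ-injective (+-cancelʳ-≡ (toℕ b) (toℕ a) (toℕ a′) (trans ab≡s (sym a′b′≡s)))) })
    ∷ fresh-partner⁻¹ as bs levels a∉as

count-partners : {n : ℕ} (s : ℕ) {k : ℕ} (x : Vec (Fin n) k) →
  (∑[ y ∈ allWords n k ] ⟦ unique? (toList y) ⟧ * ⟦ all? (_≟ s) (zipWith level (toList x) (toList y)) ⟧)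
    ≡ ⟦ unique? (toList x) ⟧ * ⟦ all? (hasPartner? s) (toList x) ⟧
count-partners s Vec.[] = refl
count-partners {n} s {suc k} (a Vec.∷ as) = begin
  ∑ (allWords n (suc k)) T
    ≡⟨ ∑-allWords-suc n k T ⟩
  (∑[ w ∈ W ] ∑[ b ∈ allFin n ] T (b Vec.∷ w))
    ≡⟨ ∑-cong W (λ w → ∑-cong (allFin n) (transfer w)) ⟩
  (∑[ w ∈ W ] ∑[ b ∈ allFin n ] C w * ⟦ level a b ≟ s ⟧)
    ≡⟨ ∑-cong W (λ w → trans (∑-*ˡ (allFin n) (C w) _) (cong (C w *_) (∑-partners s a))) ⟩
  (∑[ w ∈ W ] C w * ⟦ hasPartner? s a ⟧)
    ≡⟨ ∑-*ʳ W ⟦ hasPartner? s a ⟧ C ⟩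
  ∑ W C * ⟦ hasPartner? s a ⟧
    ≡⟨ cong (_* ⟦ hasPartner? s a ⟧) (∑-*ˡ W a∉as R) ⟩
  a∉as * ∑ W R * ⟦ hasPartner? s a ⟧
    ≡⟨ cong (λ z → a∉as * z * ⟦ hasPartner? s a ⟧) (count-partners s as) ⟩
  a∉as * (⟦ unique? (toList as) ⟧ * as✓) * ⟦ hasPartner? s a ⟧
    ≡⟨ rearrange a∉as ⟦ unique? (toList as) ⟧ as✓ ⟦ hasPartner? s a ⟧ ⟩
  a∉as * ⟦ unique? (toList as) ⟧ * (⟦ hasPartner? s a ⟧ * as✓)
    ≡⟨ cong₂ _*_ (⟦unique?⟧-∷ a (toList as)) (⟦all?⟧-∷ (hasPartner? s) a (toList as)) ⟨
  ⟦ unique? (a ∷ toList as) ⟧ * ⟦ all? (hasPartner? s) (a ∷ toList as) ⟧ ∎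
  where
  open ≡-Reasoning
  W = allWords n k
  a∉as = ⟦ fresh? a (toList as) ⟧
  as✓ = ⟦ all? (hasPartner? s) (toList as) ⟧
  T : Vec (Fin n) (suc k) → ℕ
  T y = ⟦ unique? (toList y) ⟧ * ⟦ all? (_≟ s) (zipWith level (a ∷ toList as) (toList y)) ⟧
  R C : Vec (Fin n) k → ℕ
  R w = ⟦ unique? (toList w) ⟧ * ⟦ all? (_≟ s) (zipWith level (toList as) (toList w)) ⟧
  C w = a∉as * R w
  rearrange : ∀ x y z t → x * (y * z) * t ≡ x * y * (t * z)
  rearrange = solve-∀
  transfer : ∀ w b → T (b Vec.∷ w) ≡ C w * ⟦ level a b ≟ s ⟧
  transfer w b = begin
    ⟦ unique? (b ∷ toList w) ⟧ * ⟦ L ⟧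
      ≡⟨ cong (_* ⟦ L ⟧) (⟦unique?⟧-∷ b (toList w)) ⟩
    ⟦ fresh? b (toList w) ⟧ * ⟦ unique? (toList w) ⟧ * ⟦ L ⟧
      ≡⟨ *-CS.xy∙z≈y∙zx ⟦ fresh? b (toList w) ⟧ _ _ ⟩
    ⟦ unique? (toList w) ⟧ * (⟦ L ⟧ * ⟦ fresh? b (toList w) ⟧)
      ≡⟨ cong (⟦ unique? (toList w) ⟧ *_) same-freshness ⟩
    ⟦ unique? (toList w) ⟧ * (⟦ L ⟧ * a∉as)
      ≡⟨ cong (λ z → ⟦ unique? (toList w) ⟧ * (z * a∉as)) (⟦⟧-×-dec (level a b ≟ s) A?) ⟩
    ⟦ unique? (toList w) ⟧ * (⟦ level a b ≟ s ⟧ * ⟦ A? ⟧ * a∉as)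
      ≡⟨ regroup ⟦ unique? (toList w) ⟧ ⟦ level a b ≟ s ⟧ ⟦ A? ⟧ a∉as ⟩
    a∉as * (⟦ unique? (toList w) ⟧ * ⟦ A? ⟧) * ⟦ level a b ≟ s ⟧ ∎
    where
    A? = all? (_≟ s) (zipWith level (toList as) (toList w))
    L = level a b ≟ s ×-dec A?
    same-freshness : ⟦ L ⟧ * ⟦ fresh? b (toList w) ⟧ ≡ ⟦ L ⟧ * a∉as
    same-freshness = ⟦⟧-*-congˡ L (fresh? b (toList w)) (fresh? a (toList as))
      (λ (ab≡s , levels) → fresh-partner ab≡s as w levels)
      (λ (ab≡s , levels) → fresh-partner⁻¹ ab≡s as w levels)
    regroup : ∀ u e x f → u * (e * x * f) ≡ f * (u * x) * e
    regroup = solve-∀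

constantLevelPairs : ℕ → ℕ → ℕ
constantLevelPairs n k =
  ∑[ x ∈ allWords n k ] ⟦ unique? (toList x) ⟧ *
    (∑[ y ∈ allWords n k ] ⟦ unique? (toList y) ⟧ * constant (zipWith level (toList x) (toList y)))

constantLevelPairs-levels : (n′ k′ : ℕ) →
  constantLevelPairs (suc n′) (suc k′) ≡ (∑[ s < suc n′ + n′ ] (count (hasPartner? {suc n′} s)) P′ suc k′)
constantLevelPairs-levels n′ k′ = begin
  constantLevelPairs n k
    ≡⟨ ∑-cong W (λ x → cong (U x *_) (∑-cong W (λ y → cong (U y *_) (constant-levels x y)))) ⟩
  (∑[ x ∈ W ] U x * (∑[ y ∈ W ] U y * (∑[ s < N ] A s x y)))
    ≡⟨ ∑-cong W (λ x → cong (U x *_) (by-level x)) ⟩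
  (∑[ x ∈ W ] U x * (∑[ s < N ] U x * P s x))
    ≡⟨ ∑-cong W (λ x → trans (sym (∑<-*ˡ N (U x) (λ s → U x * P s x))) (∑<-cong N (λ s _ → idem x s))) ⟩
  (∑[ x ∈ W ] ∑[ s < N ] P s x * ⟦ unique? (toList x ++ []) ⟧)
    ≡⟨ ∑-∑<-comm W N (λ x s → P s x * ⟦ unique? (toList x ++ []) ⟧) ⟩
  (∑[ s < N ] ∑[ x ∈ W ] P s x * ⟦ unique? (toList x ++ []) ⟧)
    ≡⟨ ∑<-cong N (λ s _ → trans (count-unique-prefixes-in (hasPartner? {n} s) [] [] k) (+-identityʳ _)) ⟩
  (∑[ s < N ] (count (hasPartner? {n} s)) P′ k) ∎
  where
  open ≡-Reasoning
  n = suc n′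
  k = suc k′
  N = suc n′ + n′
  W = allWords n k
  U : Vec (Fin n) k → ℕ
  U x = ⟦ unique? (toList x) ⟧
  P : ℕ → Vec (Fin n) k → ℕ
  P s x = ⟦ all? (hasPartner? s) (toList x) ⟧
  A : ℕ → Vec (Fin n) k → Vec (Fin n) k → ℕ
  A s x y = ⟦ all? (_≟ s) (zipWith level (toList x) (toList y)) ⟧
  constant-levels : (x y : Vec (Fin n) k) → constant (zipWith level (toList x) (toList y)) ≡ (∑[ s < N ] A s x y)
  constant-levels (a Vec.∷ as) (b Vec.∷ bs) =
    constant-∑ N (level a b) (zipWith level (toList as) (toList bs)) (s≤s (+-mono-≤ (toℕ≤pred[n] a) (toℕ≤pred[n] b)))
  by-level : (x : Vec (Fin n) k) → (∑[ y ∈ W ] U y * (∑[ s < N ] A s x y)) ≡ (∑[ s < N ] U x * P s x)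
  by-level x = begin
    (∑[ y ∈ W ] U y * (∑[ s < N ] A s x y)) ≡⟨ ∑-cong W (λ y → sym (∑<-*ˡ N (U y) (λ s → A s x y))) ⟩
    (∑[ y ∈ W ] ∑[ s < N ] U y * A s x y)   ≡⟨ ∑-∑<-comm W N (λ y s → U y * A s x y) ⟩
    (∑[ s < N ] ∑[ y ∈ W ] U y * A s x y)   ≡⟨ ∑<-cong N (λ s _ → count-partners s x) ⟩
    (∑[ s < N ] U x * P s x)                ∎
  idem : (x : Vec (Fin n) k) (s : ℕ) → U x * (U x * P s x) ≡ P s x * ⟦ unique? (toList x ++ []) ⟧
  idem x s = begin
    U x * (U x * P s x) ≡⟨ *-assoc (U x) (U x) (P s x) ⟨
    U x * U x * P s x   ≡⟨ cong (_* P s x) (⟦⟧-idem (unique? (toList x))) ⟩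
    U x * P s x         ≡⟨ *-comm (U x) (P s x) ⟩
    P s x * U x         ≡⟨ cong (λ xs → P s x * ⟦ unique? xs ⟧) (List.++-identityʳ (toList x)) ⟨
    P s x * ⟦ unique? (toList x ++ []) ⟧ ∎

-- Plateaux

⟦isPlateauAt?⟧ : {n : ℕ} (k : ℕ) (Π : Vec (Fin n) n × Vec (Fin n) n) (j : ℕ) →
  ⟦ isPlateauAt? k Π j ⟧ ≡ constant (take k (drop j (levels Π)))
⟦isPlateauAt?⟧ k Π j with take k (drop j (levels Π))
... | []     = refl
... | _ ∷ _  = refl

plateaux-at : {n : ℕ} (j k r : ℕ) → j + (k + r) ≡ n →
  (∑[ Π ∈ S3n n ] ⟦ isPlateauAt? k Π j ⟧) ≡ (n ∸ k) ! * ((n ∸ k) ! * constantLevelPairs n k)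
plateaux-at {n} j k r refl = begin
  (∑[ Π ∈ S3n n ] ⟦ isPlateauAt? k Π j ⟧)
    ≡⟨ ∑-cartesianProduct (Sn n) (Sn n) _ ⟩
  (∑[ p ∈ Sn n ] ∑[ q ∈ Sn n ] ⟦ isPlateauAt? k (p , q) j ⟧)
    ≡⟨ ∑-filter isPerm? W _ ⟩
  (∑[ p ∈ W ] U p * (∑[ q ∈ Sn n ] ⟦ isPlateauAt? k (p , q) j ⟧))
    ≡⟨ ∑-cong W (λ p → cong (U p *_) (trans (∑-filter isPerm? W _) (∑-cong W (λ q → cong (U q *_) (windows p q))))) ⟩
  (∑[ p ∈ W ] U p * (∑[ q ∈ W ] U q * constant (zipWith level (window p) (window q))))
    ≡⟨ ∑-cong W (λ p → cong (U p *_) (∑-window j k r (λ ys → constant (zipWith level (window p) ys)))) ⟩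
  (∑[ p ∈ W ] U p * (R * G (window p)))
    ≡⟨ ∑-cong W (λ p → *-CS.x∙yz≈y∙xz (U p) R (G (window p))) ⟩
  (∑[ p ∈ W ] R * (U p * G (window p)))
    ≡⟨ ∑-*ˡ W R _ ⟩
  R * (∑[ p ∈ W ] U p * G (window p))
    ≡⟨ cong (R *_) (∑-window j k r G) ⟩
  R * (R * constantLevelPairs n k)
    ≡⟨ cong (λ z → z * (z * constantLevelPairs n k)) R≡[n∸k]! ⟩
  (n ∸ k) ! * ((n ∸ k) ! * constantLevelPairs n k) ∎
  where
  open ≡-Reasoning
  W = allWords n n
  U : Vec (Fin n) n → ℕ
  U p = ⟦ isPerm? p ⟧
  window : {m : ℕ} → Vec (Fin n) m → List (Fin n)
  window p = take k (drop j (toList p))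
  G : List (Fin n) → ℕ
  G xs = ∑[ y ∈ allWords n k ] ⟦ unique? (toList y) ⟧ * constant (zipWith level xs (toList y))
  R = (n ∸ k) P′ (r + j)
  windows : (p q : Vec (Fin n) n) → ⟦ isPlateauAt? k (p , q) j ⟧ ≡ constant (zipWith level (window p) (window q))
  windows p q = trans (⟦isPlateauAt?⟧ k (p , q) j)
    (cong constant (trans (cong (take k) (drop-zipWith level j (toList p) (toList q))) (take-zipWith level k _ _)))
  n∸k≡r+j : n ∸ k ≡ r + j
  n∸k≡r+j = trans (cong (_∸ k) (+-CS.x∙yz≈y∙xz j k r)) (trans (m+n∸m≡n k (j + r)) (+-comm j r))
  R≡[n∸k]! : R ≡ (n ∸ k) !
  R≡[n∸k]! = trans (cong ((n ∸ k) P′_) (sym n∸k≡r+j)) (P′-self (n ∸ k))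

totalPlateaux-windows : {n k : ℕ} → k ≤ n →
  totalPlateaux n k ≡ (n ∸ k + 1) ! * (n ∸ k) ! * constantLevelPairs n k
totalPlateaux-windows {n} {k} k≤n = begin
  (∑[ Π ∈ S3n n ] length (filter (isPlateauAt? k Π) (upTo (m + 1))))
    ≡⟨ ∑-cong (S3n n) (λ Π → length-filter (isPlateauAt? k Π) (upTo (m + 1))) ⟩
  (∑[ Π ∈ S3n n ] ∑[ j ∈ upTo (m + 1) ] ⟦ isPlateauAt? k Π j ⟧)
    ≡⟨ ∑-comm (S3n n) (upTo (m + 1)) _ ⟩
  (∑[ j ∈ upTo (m + 1) ] ∑[ Π ∈ S3n n ] ⟦ isPlateauAt? k Π j ⟧)
    ≡⟨ ∑-upTo (m + 1) _ ⟩
  (∑[ j < m + 1 ] ∑[ Π ∈ S3n n ] ⟦ isPlateauAt? k Π j ⟧)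
    ≡⟨ ∑<-cong (m + 1) (λ j j<N → plateaux-at j k (m ∸ j) (fits j j<N)) ⟩
  (∑[ j < m + 1 ] m ! * (m ! * D))
    ≡⟨ ∑<-const (m + 1) _ ⟩
  (m + 1) * (m ! * (m ! * D))
    ≡⟨ *-CS.x∙yz≈xy∙z (m + 1) (m !) _ ⟩
  (m + 1) * m ! * (m ! * D)
    ≡⟨ cong (_* (m ! * D)) [m+1]*m!≡[m+1]! ⟩
  (m + 1) ! * (m ! * D)
    ≡⟨ *-assoc ((m + 1) !) (m !) D ⟨
  (m + 1) ! * m ! * D ∎
  where
  open ≡-Reasoning
  m = n ∸ k
  D = constantLevelPairs n k
  fits : ∀ j → j < m + 1 → j + (k + (m ∸ j)) ≡ n
  fits j j<m+1 = begin
    j + (k + (m ∸ j)) ≡⟨ +-CS.x∙yz≈y∙xz j k _ ⟩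
    k + (j + (m ∸ j)) ≡⟨ cong (k +_) (m+[n∸m]≡n (s≤s⁻¹ (subst (j <_) (+-comm m 1) j<m+1))) ⟩
    k + m             ≡⟨ m+[n∸m]≡n k≤n ⟩
    n                 ∎
  [m+1]*m!≡[m+1]! : (m + 1) * m ! ≡ (m + 1) !
  [m+1]*m!≡[m+1]! = trans (cong (_* m !) (+-comm m 1)) (cong _! (+-comm 1 m))

∑-falling : (m k′ : ℕ) → k′ ≤ suc m →
  sumFromTo k′ m (λ ℓ → ((ℓ + 1) ! / (ℓ + 1 ∸ suc k′) !) {{(ℓ + 1 ∸ suc k′) !≢0}})
    ≡ (∑[ t < suc m ] (suc t) P′ suc k′)
∑-falling m k′ k′≤1+m = begin
  ∑ (upTo M) (λ t → f (k′ + t))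
    ≡⟨ ∑-upTo M _ ⟩
  (∑[ t < M ] f (k′ + t))
    ≡⟨ ∑<-cong M (λ t _ → quotient t) ⟩
  (∑[ t < M ] h (k′ + t))
    ≡⟨ cong (_+ (∑[ t < M ] h (k′ + t))) (∑<-zero k′) ⟨
  (∑[ t < k′ ] 0) + (∑[ t < M ] h (k′ + t))
    ≡⟨ cong (_+ (∑[ t < M ] h (k′ + t))) (∑<-cong k′ (λ t t<k′ → sym (P′-vanishes (s≤s t<k′)))) ⟩
  ∑< k′ h + (∑[ t < M ] h (k′ + t))
    ≡⟨ ∑<-+ k′ M h ⟨
  ∑< (k′ + M) h
    ≡⟨ cong (λ N → ∑< N h) (m+[n∸m]≡n k′≤1+m) ⟩
  ∑< (suc m) h ∎
  where
  open ≡-Reasoning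
  M = suc m ∸ k′
  f h : ℕ → ℕ
  f ℓ = ((ℓ + 1) ! / (ℓ + 1 ∸ suc k′) !) {{(ℓ + 1 ∸ suc k′) !≢0}}
  h t = (suc t) P′ suc k′
  quotient : ∀ t → f (k′ + t) ≡ h (k′ + t)
  quotient t = trans (sym (P′≡!/! (subst (suc k′ ≤_) (+-comm 1 (k′ + t)) (s≤s (m≤m+n k′ t)))))
                     (cong (_P′ suc k′) (+-comm (k′ + t) 1))

theorem4p17 : (n k : ℕ) → 2 ≤ n → 2 ≤ k → k ≤ n → totalPlateaux n k ≡ formula n k
theorem4p17 n@(suc n′@(suc n″)) k@(suc k′) (s≤s (s≤s _)) _ k≤n = begin
  totalPlateaux n k
    ≡⟨ totalPlateaux-windows k≤n ⟩
  prefactor * constantLevelPairs n k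
    ≡⟨ cong (prefactor *_) (constantLevelPairs-levels n′ k′) ⟩
  prefactor * (∑[ s < n + n′ ] c s P′ k)
    ≡⟨ cong (prefactor *_) (∑-levels n′ k) ⟩
  (n ∸ k + 1) ! * (n ∸ k) ! * (n P′ k + 2 * (∑[ t < n′ ] (suc t) P′ k))
    ≡⟨ cong₂ (λ a b → prefactor * (a + 2 * b)) (P′≡!/! k≤n) (sym (∑-falling n″ k′ (s≤s⁻¹ k≤n))) ⟩
  formula n k ∎
  where
  open ≡-Reasoning
  prefactor = (n ∸ k + 1) ! * (n ∸ k) !
  c : ℕ → ℕ
  c s = count (hasPartner? {n} s)
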